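{- Let $D$ be a digraph and $(x,y),(x',y')\in Z_D$ with $(x,y)\Gamma^*(x',y')$. Then there is a canonical $\Gamma$-chain connecting $(x,y)$ and $(x',y')$.
   Context: A digraph $D=(V,A)$ is finite, without loops or multiple arcs; write $uv\in A$ for an arc. Let $Z_D=\{(x,y): xy\in A\text{ or }yx\in A\}$. For $(x,y),(x',y')\in Z_D$ write $(x,y)\Gamma(x',y')$ if one of the following holds: (i) $x=x'$ and $y=y'$; (ii) $x=x'$, $y\ne y'$, and either ($yx,x'y'\in A$ and $yy'\notin A$) or ($y'x',xy\in A$ and $y'y\notin A$); (iii) $y=y'$, $x\ne x'$, and either ($xy,y'x'\in A$ and $xx'\notin A$) or ($x'y',yx\in A$ and $x'x\notin A$). $\Gamma^*$ is the transitive closure of $\Gamma$. A $\Gamma$-chain connecting $(x,y)$ and $(x',y')$ is a sequence $(x_0,y_0),\dots,(x_k,y_k)$ of pairs in $Z_D$ with $(x_0,y_0)=(x,y)$, $(x_k,y_k)=(x',y')$ and $(x_{i-1},y_{i-1})\Gamma(x_i,y_i)$ for $1\le i\le k$. It is canonical if $x_i=x_{i+1}$ and $y_i=y_{i-1}$ for every odd $i$ (with $0<i<k$). -}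

module Defs where

open import Data.Nat using (ℕ; zero; suc; _<_; _%_)
open import Data.Fin using (Fin)
open import Data.Product using (_×_; _,_; proj₁; proj₂; Σ)
open import Data.Sum using (_⊎_)
open import Relation.Nullary using (¬_)
open import Relation.Binary.PropositionalEquality using (_≡_; _≢_)
open import Relation.Binary.Construct.Closure.Transitive using (TransClosure)

record Digraph : Set₁ where
  field
    n     : ℕ
    Arc   : Fin n → Fin n → Set
    loopless : ∀ v → ¬ Arc v v

module _ (D : Digraph) where
  open Digraph D

  V : Set
  V = Fin n

  Z : V × V → Set
  Z (x , y) = Arc x y ⊎ Arc y x

  Γcore : V × V → V × V → Set
  Γcore (x , y) (x' , y') =
      (x ≡ x' × y ≡ y')
    ⊎ (x ≡ x' × y ≢ y' ×
        ((Arc y x × Arc x' y' × ¬ Arc y y') ⊎ (Arc y' x' × Arc x y × ¬ Arc y' y)))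
    ⊎ (y ≡ y' × x ≢ x' ×
        ((Arc x y × Arc y' x' × ¬ Arc x x') ⊎ (Arc x' y' × Arc y x × ¬ Arc x' x)))

  Γ : V × V → V × V → Set
  Γ p q = Z p × Z q × Γcore p q

  Γ* : V × V → V × V → Set
  Γ* = TransClosure Γ

  -- A Γ-chain (x_0,y_0),…,(x_k,y_k) given by a sequence c (only indices 0..k matter)
  record GammaChain (p q : V × V) : Set where
    field
      k      : ℕ
      c      : ℕ → V × V
      inZ    : ∀ i → i < suc k → Z (c i)
      start  : c 0 ≡ p
      end    : c k ≡ q
      steps  : ∀ i → i < k → Γ (c i) (c (suc i))

  open GammaChain public

  -- canonical: x_i = x_{i+1} and y_i = y_{i-1} for every odd i with 0 < i < k
  Canonical : ∀ {p q} → GammaChain p q → Set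
  Canonical ch = ∀ j → suc j < k ch → suc j % 2 ≡ 1 →
    proj₁ (c ch (suc j)) ≡ proj₁ (c ch (suc (suc j))) ×
    proj₂ (c ch (suc j)) ≡ proj₂ (c ch j)

-- Every Γ-step changes at most one coordinate, and Γ is reflexive on Z_D.
-- Padding each step with a reflexive step therefore turns any Γ-chain into
-- one that alternates a step keeping y with a step keeping x, which is
-- exactly a canonical chain read off in pairs.
module Submission where

open import Defs
open import Data.Product using (_×_; Σ; _,_; proj₁; proj₂)
open import Data.Sum using (inj₁; inj₂)
open import Data.Nat using (ℕ; zero; suc; _<_; _%_; s≤s)
open import Data.Nat.DivMod using (%-remove-+ˡ)
open import Data.Nat.Divisibility using (∣-refl)
open import Relation.Binary.PropositionalEquality using (_≡_; refl; sym; trans; cong; subst)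
open import Relation.Binary.Construct.Closure.Transitive using ([_]; _∷_)

[2+n]%2≡n%2 : ∀ n → suc (suc n) % 2 ≡ n % 2
[2+n]%2≡n%2 n = %-remove-+ˡ n ∣-refl

module _ {D : Digraph} where

  private
    Pair : Set
    Pair = V D × V D

  Γ-refl : ∀ {p} → Z D p → Γ D p p
  Γ-refl z = z , z , inj₁ (refl , refl)

  data Zigzag : Pair → Pair → Set where
    stop   : ∀ {p} → Z D p → Zigzag p p
    zigzag : ∀ {p q r s} → Γ D p q → proj₂ p ≡ proj₂ q →
             Γ D q r → proj₁ q ≡ proj₁ r → Zigzag r s → Zigzag p s

  _++_ : ∀ {p q r} → Zigzag p q → Zigzag q r → Zigzag p r
  stop _           ++ b = b
  zigzag g e h f a ++ b = zigzag g e h f (a ++ b)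

  Γ⇒Zigzag : ∀ {p q} → Γ D p q → Zigzag p q
  Γ⇒Zigzag g@(_  , zq , inj₁ (_ , y≡y'))        = zigzag g y≡y' (Γ-refl zq) refl (stop zq)
  Γ⇒Zigzag g@(zp , zq , inj₂ (inj₁ (x≡x' , _))) = zigzag (Γ-refl zp) refl g x≡x' (stop zq)
  Γ⇒Zigzag g@(_  , zq , inj₂ (inj₂ (y≡y' , _))) = zigzag g y≡y' (Γ-refl zq) refl (stop zq)

  Γ*⇒Zigzag : ∀ {p q} → Γ* D p q → Zigzag p q
  Γ*⇒Zigzag [ g ]   = Γ⇒Zigzag g
  Γ*⇒Zigzag (g ∷ t) = Γ⇒Zigzag g ++ Γ*⇒Zigzag t

  length : ∀ {p q} → Zigzag p q → ℕ
  length (stop _)           = 0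
  length (zigzag _ _ _ _ a) = suc (suc (length a))

  -- Indices beyond the length yield the last pair.
  pairAt : ∀ {p q} → Zigzag p q → ℕ → Pair
  pairAt (stop {p} _)               _             = p
  pairAt (zigzag {p} _ _ _ _ _)     zero          = p
  pairAt (zigzag {q = q} _ _ _ _ _) (suc zero)    = q
  pairAt (zigzag _ _ _ _ a)         (suc (suc i)) = pairAt a i

  pairAt-first : ∀ {p q} (a : Zigzag p q) → pairAt a 0 ≡ p
  pairAt-first (stop _)           = refl
  pairAt-first (zigzag _ _ _ _ _) = refl

  pairAt-last : ∀ {p q} (a : Zigzag p q) → pairAt a (length a) ≡ q
  pairAt-last (stop _)           = refl
  pairAt-last (zigzag _ _ _ _ a) = pairAt-last a

  pairAt-Z : ∀ {p q} (a : Zigzag p q) i → i < suc (length a) → Z D (pairAt a i)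
  pairAt-Z (stop z)           _             _               = z
  pairAt-Z (zigzag g _ _ _ _) zero          _               = proj₁ g
  pairAt-Z (zigzag _ _ h _ _) (suc zero)    _               = proj₁ h
  pairAt-Z (zigzag _ _ _ _ a) (suc (suc i)) (s≤s (s≤s i<)) = pairAt-Z a i i<

  pairAt-Γ : ∀ {p q} (a : Zigzag p q) i → i < length a →
             Γ D (pairAt a i) (pairAt a (suc i))
  pairAt-Γ (zigzag g _ _ _ _) zero          _               = g
  pairAt-Γ (zigzag _ _ h _ a) (suc zero)    _               = subst (Γ D _) (sym (pairAt-first a)) h
  pairAt-Γ (zigzag _ _ _ _ a) (suc (suc i)) (s≤s (s≤s i<)) = pairAt-Γ a i i<

  toGammaChain : ∀ {p q} → Zigzag p q → GammaChain D p q
  toGammaChain a = record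
    { k     = length a
    ; c     = pairAt a
    ; inZ   = pairAt-Z a
    ; start = pairAt-first a
    ; end   = pairAt-last a
    ; steps = pairAt-Γ a
    }

  toGammaChain-canonical : ∀ {p q} (a : Zigzag p q) → Canonical D (toGammaChain a)
  toGammaChain-canonical (stop _)           _             ()              _
  toGammaChain-canonical (zigzag _ e _ f a) zero          _               _ =
    trans f (cong proj₁ (sym (pairAt-first a))) , sym e
  toGammaChain-canonical (zigzag _ _ _ _ _) (suc zero)    _               ()
  toGammaChain-canonical (zigzag _ _ _ _ a) (suc (suc j)) (s≤s (s≤s j<)) odd =
    toGammaChain-canonical a j j< (trans (sym ([2+n]%2≡n%2 (suc j))) odd)

mainTheorem9 : (D : Digraph) → (p q : V D × V D) → Z D p → Z D q → Γ* D p q →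
    Σ (GammaChain D p q) (λ ch → Canonical D ch)
mainTheorem9 D p q _ _ p⟶q = toGammaChain zz , toGammaChain-canonical zz
  where
    zz : Zigzag p q
    zz = Γ*⇒Zigzag p⟶q
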